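{- Let $q\ge 2$, $n\ge 1$, $d\ge 1$ be integers and let $F:Q^V\to Q^V$ be an automata network with $Q=\{0,\dots,q-1\}$, $V=\{1,\dots,n\}$, of degree at most $d$. For $k\ge 0$ let $Y_k=\{y\in Q^V: |F^{ -1}(y)|=k\}$ and $Y_{\ge 2}=\bigcup_{k\ge 2}Y_k$. If $|Y_0|\ge 1$ and $|Y_{\ge 2}|\le\lfloor n/d\rfloor$, then $|Y_0|\ge q^{\,n-|Y_{\ge 2}|d}$.
   Context: An automata network is a map $F:Q^V\to Q^V$ with local functions $f_j(x)=F(x)_j$. Its interaction graph has an arc $(i,j)$ iff $f_j$ effectively depends on $x_i$ (there exist $x,x'$ differing only at $i$ with $f_j(x)\neq f_j(x')$). The degree of $F$ is the maximum in-degree of its interaction graph. -}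

module Defs where

open import Data.Nat using (ℕ; zero; suc; _≤_; _≤?_; _≟_)
open import Data.Fin using (Fin)
import Data.Fin.Properties as FinP
open import Data.Vec using (Vec; []; _∷_; lookup)
open import Data.Vec.Properties using (≡-dec)
open import Data.List using (List; [_]; map; concatMap; allFin; filter; length)
open import Data.Product using (Σ; ∃; _×_)
open import Relation.Binary.PropositionalEquality using (_≡_; _≢_)
open import Relation.Nullary using (¬_)
open import Data.Fin.Subset using (Subset; _∈_; ∣_∣)

Config : ℕ → ℕ → Set
Config q n = Vec (Fin q) n

AN : ℕ → ℕ → Set
AN q n = Config q n → Config q n

DifferOnlyAt : ∀ {q n} → Fin n → Config q n → Config q n → Set
DifferOnlyAt i x x' = ∀ k → k ≢ i → lookup x k ≡ lookup x' k

-- Arc (i , j) of the interaction graph: f_j effectively depends on x_i.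
Arc : ∀ {q n} → AN q n → Fin n → Fin n → Set
Arc F i j = ∃ λ x → ∃ λ x' →
  DifferOnlyAt i x x' × lookup (F x) j ≢ lookup (F x') j

InDegreeAtMost : ∀ {q n} → AN q n → ℕ → Fin n → Set
InDegreeAtMost {n = n} F d j =
  Σ (Subset n) λ S → (∣ S ∣ ≤ d) × (∀ i → Arc F i j → i ∈ S)

DegreeAtMost : ∀ {q n} → AN q n → ℕ → Set
DegreeAtMost F d = ∀ j → InDegreeAtMost F d j

allConfigs : (q n : ℕ) → List (Config q n)
allConfigs q zero = [ [] ]
allConfigs q (suc n) = concatMap (λ a → map (a ∷_) (allConfigs q n)) (allFin q)

preimageCount : ∀ {q n} → AN q n → Config q n → ℕ
preimageCount {q} {n} F y =
  length (filter (λ x → ≡-dec FinP._≟_ (F x) y) (allConfigs q n))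

cardY0 : ∀ {q n} → AN q n → ℕ
cardY0 {q} {n} F =
  length (filter (λ y → preimageCount F y ≟ 0) (allConfigs q n))

cardY≥2 : ∀ {q n} → AN q n → ℕ
cardY≥2 {q} {n} F =
  length (filter (λ y → 2 ≤? preimageCount F y) (allConfigs q n))

-- Fix y₀ ∈ Y₀ and, for every y ∈ Y_{≥2}, a coordinate j(y) at which y differs from y₀.
-- Let Z be the set of configurations agreeing with y₀ at all these coordinates. Membership
-- in Z depends on at most |Y_{≥2}| coordinates, and membership of F(x) in Z on at most
-- |Y_{≥2}|·d coordinates of x (the in-neighbourhoods of the j(y)), so q^(n - |Y_{≥2}|d)
-- divides both |Z| and |F⁻¹(Z)|. Since Z avoids Y_{≥2}, |Z| = |Z ∩ Y₀| + |F⁻¹(Z)|, hence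
-- q^(n - |Y_{≥2}|d) divides |Z ∩ Y₀|, which is positive because it contains y₀.
module Submission where

open import Defs
open import Algebra.Properties.CommutativeSemigroup using (interchange)
open import Data.Empty using (⊥-elim)
open import Data.Fin using (Fin; zero; suc; fromℕ<)
open import Data.Fin.Properties using (any?; suc-injective) renaming (_≟_ to _≟ᶠ_)
open import Data.Fin.Subset using (Subset; inside; outside; _∪_; ⁅_⁆; ⋃; ∣_∣; _⊆_)
  renaming (_∈_ to _∈ₛ_)
open import Data.Fin.Subset.Properties using (drop-there; x∈⁅x⁆; ∣⊥∣≡0; ∣⁅x⁆∣≡1; ∣p∣≤n; p⊆p∪q; q⊆p∪q)
open import Data.List using (List; []; _∷_; _++_; map; concat; concatMap; length; filter; allFin)
open import Data.List.Properties using (map-tabulate; length-tabulate)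
open import Data.List.Membership.Propositional using (_∈_)
open import Data.List.Membership.Propositional.Properties
  using (∈-map⁺; ∈-concat⁺′; ∈-allFin; ∈-filter⁺)
open import Data.List.Relation.Unary.All as All using (All; all?)
open import Data.List.Relation.Unary.Any using (here; there)
open import Data.Nat using (ℕ; zero; suc; _+_; _*_; _∸_; _^_; _/_; _≤_; _≤?_; z≤n; s≤s; NonZero; >-nonZero; >-nonZero⁻¹)
import Data.Nat as ℕ
open import Data.Nat.Divisibility
  using (_∣_; divides; 1∣_; ∣-trans; ∣⇒≤; ∣m∣n⇒∣m+n; ∣m+n∣m⇒∣n; *-monoʳ-∣)
open import Data.Nat.Properties hiding (suc-injective)
open import Data.Product using (∃; _×_; _,_; proj₁; proj₂)
open import Data.Sum using (_⊎_; inj₁; inj₂)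
open import Data.Vec using ([]; _∷_; lookup; _[_]≔_)
open import Data.Vec.Properties using (≡-dec; ∷-injective; lookup∘update; lookup∘update′; []≔-lookup)
open import Data.Vec.Relation.Binary.Pointwise.Extensional using (ext; Pointwise-≡⇒≡)
open import Function using (_∘_)
open import Relation.Binary.Definitions using (DecidableEquality)
open import Relation.Binary.PropositionalEquality
  using (_≡_; _≢_; refl; sym; trans; cong; cong₂; subst; subst₂; module ≡-Reasoning)
open import Relation.Nullary using (Dec; yes; no; ¬_; ¬?; _×-dec_)
open import Relation.Nullary.Decidable using (decidable-stable)
open import Relation.Unary using (Decidable)

-- Sums over lists and indicators

∑ : ∀ {a} {A : Set a} → (A → ℕ) → List A → ℕ
∑ f [] = 0
∑ f (x ∷ xs) = f x + ∑ f xs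

syntax ∑ (λ x → e) xs = ∑[ x ← xs ] e

indicator : ∀ {p} {P : Set p} → Dec P → ℕ
indicator (yes _) = 1
indicator (no _) = 0

module _ {a} {A : Set a} where

  ∑-cong : ∀ {f g : A → ℕ} xs → (∀ x → f x ≡ g x) → ∑ f xs ≡ ∑ g xs
  ∑-cong [] _ = refl
  ∑-cong (x ∷ xs) f≗g = cong₂ _+_ (f≗g x) (∑-cong xs f≗g)

  ∑-mono-≤ : ∀ {f g : A → ℕ} xs → (∀ x → f x ≤ g x) → ∑ f xs ≤ ∑ g xs
  ∑-mono-≤ [] _ = z≤n
  ∑-mono-≤ (x ∷ xs) f≤g = +-mono-≤ (f≤g x) (∑-mono-≤ xs f≤g)

  ∑-distrib-+ : ∀ (f g : A → ℕ) xs → ∑[ x ← xs ] (f x + g x) ≡ ∑ f xs + ∑ g xs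
  ∑-distrib-+ f g [] = refl
  ∑-distrib-+ f g (x ∷ xs) =
    trans (cong (f x + g x +_) (∑-distrib-+ f g xs))
          (interchange +-commutativeSemigroup (f x) (g x) (∑ f xs) (∑ g xs))

  ∑-*ˡ : ∀ c (f : A → ℕ) xs → ∑[ x ← xs ] (c * f x) ≡ c * ∑ f xs
  ∑-*ˡ c f [] = sym (*-zeroʳ c)
  ∑-*ˡ c f (x ∷ xs) = trans (cong (c * f x +_) (∑-*ˡ c f xs)) (sym (*-distribˡ-+ c (f x) (∑ f xs)))

  ∑-const : ∀ c (xs : List A) → ∑[ x ← xs ] c ≡ length xs * c
  ∑-const c [] = refl
  ∑-const c (x ∷ xs) = cong (c +_) (∑-const c xs)

  ∑-zero : ∀ {f : A → ℕ} xs → (∀ x → f x ≡ 0) → ∑ f xs ≡ 0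
  ∑-zero xs f≗0 = trans (∑-cong xs f≗0) (trans (∑-const 0 xs) (*-zeroʳ (length xs)))

  ∑-++ : ∀ (f : A → ℕ) xs ys → ∑ f (xs ++ ys) ≡ ∑ f xs + ∑ f ys
  ∑-++ f [] ys = refl
  ∑-++ f (x ∷ xs) ys = trans (cong (f x +_) (∑-++ f xs ys)) (sym (+-assoc (f x) _ _))

  ∑-∣ : ∀ {m} (f : A → ℕ) xs → (∀ x → m ∣ f x) → m ∣ ∑ f xs
  ∑-∣ f [] _ = divides 0 refl
  ∑-∣ f (x ∷ xs) m∣f = ∣m∣n⇒∣m+n (m∣f x) (∑-∣ f xs m∣f)

  ∈⇒≤∑ : ∀ (f : A → ℕ) {x} xs → x ∈ xs → f x ≤ ∑ f xs
  ∈⇒≤∑ f (y ∷ xs) (here refl) = m≤m+n (f y) _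
  ∈⇒≤∑ f (y ∷ xs) (there x∈xs) = ≤-trans (∈⇒≤∑ f xs x∈xs) (m≤n+m _ (f y))

  length-filter≡∑indicator : ∀ {p} {P : A → Set p} (P? : Decidable P) xs →
    length (filter P? xs) ≡ ∑[ x ← xs ] indicator (P? x)
  length-filter≡∑indicator P? [] = refl
  length-filter≡∑indicator P? (x ∷ xs) with P? x
  ... | yes _ = cong suc (length-filter≡∑indicator P? xs)
  ... | no _ = length-filter≡∑indicator P? xs

  filter-nonempty⇒∃ : ∀ {p} {P : A → Set p} (P? : Decidable P) xs →
    1 ≤ length (filter P? xs) → ∃ P
  filter-nonempty⇒∃ P? (x ∷ xs) nonempty with P? x
  ... | yes px = x , px
  ... | no _ = filter-nonempty⇒∃ P? xs nonempty

module _ {a b} {A : Set a} {B : Set b} where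

  ∑-map : ∀ (f : B → ℕ) (g : A → B) xs → ∑ f (map g xs) ≡ ∑ (f ∘ g) xs
  ∑-map f g [] = refl
  ∑-map f g (x ∷ xs) = cong (f (g x) +_) (∑-map f g xs)

  ∑-concatMap : ∀ (f : B → ℕ) (g : A → List B) xs →
    ∑ f (concatMap g xs) ≡ ∑[ x ← xs ] ∑ f (g x)
  ∑-concatMap f g [] = refl
  ∑-concatMap f g (x ∷ xs) =
    trans (∑-++ f (g x) (concat (map g xs))) (cong (∑ f (g x) +_) (∑-concatMap f g xs))

  ∑-comm : ∀ (f : A → B → ℕ) xs ys → ∑[ x ← xs ] ∑ (f x) ys ≡ ∑[ y ← ys ] ∑[ x ← xs ] f x y
  ∑-comm f [] ys = sym (∑-zero ys (λ _ → refl))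
  ∑-comm f (x ∷ xs) ys =
    trans (cong (∑ (f x) ys +_) (∑-comm f xs ys)) (sym (∑-distrib-+ (f x) _ ys))

indicator-cong : ∀ {p r} {P : Set p} {Q : Set r} (P? : Dec P) (Q? : Dec Q) →
  (P → Q) → (Q → P) → indicator P? ≡ indicator Q?
indicator-cong (yes _) (yes _) _ _ = refl
indicator-cong (yes p) (no ¬q) P⇒Q _ = ⊥-elim (¬q (P⇒Q p))
indicator-cong (no ¬p) (yes q) _ Q⇒P = ⊥-elim (¬p (Q⇒P q))
indicator-cong (no _) (no _) _ _ = refl

indicator-yes : ∀ {p} {P : Set p} (P? : Dec P) → P → indicator P? ≡ 1
indicator-yes (yes _) _ = refl
indicator-yes (no ¬p) p = ⊥-elim (¬p p)

indicator-no : ∀ {p} {P : Set p} (P? : Dec P) → ¬ P → indicator P? ≡ 0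
indicator-no (yes p) ¬p = ⊥-elim (¬p p)
indicator-no (no _) _ = refl

indicator-×-dec : ∀ {p r} {P : Set p} {Q : Set r} (P? : Dec P) (Q? : Dec Q) →
  indicator (P? ×-dec Q?) ≡ indicator P? * indicator Q?
indicator-×-dec (yes _) (yes _) = refl
indicator-×-dec (yes _) (no _) = refl
indicator-×-dec (no _) _ = refl

indicator≤1 : ∀ {p} {P : Set p} (P? : Dec P) → indicator P? ≤ 1
indicator≤1 (yes _) = ≤-refl
indicator≤1 (no _) = z≤n

indicator[≡0]+id : ∀ c → c ≤ 1 → indicator (c ℕ.≟ 0) + c ≡ 1
indicator[≡0]+id zero _ = refl
indicator[≡0]+id (suc zero) _ = refl
indicator[≡0]+id (suc (suc c)) (s≤s ())

∑-allFin-suc : ∀ m (f : Fin (suc m) → ℕ) → ∑ f (allFin (suc m)) ≡ f zero + ∑ (f ∘ suc) (allFin m)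
∑-allFin-suc m f =
  cong (f zero +_) (trans (cong (∑ f) (sym (map-tabulate (λ b → b) suc))) (∑-map f suc (allFin m)))

∑-allFin-indicator-≡ : ∀ {m} (a : Fin m) → ∑[ b ← allFin m ] indicator (a ≟ᶠ b) ≡ 1
∑-allFin-indicator-≡ {suc m} zero =
  trans (∑-allFin-suc m (λ b → indicator (zero ≟ᶠ b)))
        (cong suc (∑-zero (allFin m) (λ b → indicator-no (zero ≟ᶠ suc b) λ ())))
∑-allFin-indicator-≡ {suc m} (suc a) =
  trans (∑-allFin-suc m (λ b → indicator (suc a ≟ᶠ b)))
    (trans (∑-cong (allFin m) (λ b → indicator-cong (suc a ≟ᶠ suc b) (a ≟ᶠ b) suc-injective (cong suc)))
           (∑-allFin-indicator-≡ a))

-- Enumerating configurations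

infix 4 _≟ᶜ_

_≟ᶜ_ : ∀ {q n} → DecidableEquality (Config q n)
_≟ᶜ_ = ≡-dec _≟ᶠ_

∑-allConfigs-suc : ∀ q n (f : Config q (suc n) → ℕ) →
  ∑ f (allConfigs q (suc n)) ≡ ∑[ a ← allFin q ] ∑[ x ← allConfigs q n ] f (a ∷ x)
∑-allConfigs-suc q n f =
  trans (∑-concatMap f (λ a → map (a ∷_) (allConfigs q n)) (allFin q))
        (∑-cong (allFin q) (λ a → ∑-map f (a ∷_) (allConfigs q n)))

∈-allConfigs : ∀ {q n} (x : Config q n) → x ∈ allConfigs q n
∈-allConfigs [] = here refl
∈-allConfigs (a ∷ x) = ∈-concat⁺′ (∈-map⁺ (a ∷_) (∈-allConfigs x)) (∈-map⁺ _ (∈-allFin a))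

indicator-∷ : ∀ {q n} (a b : Fin q) (x y : Config q n) →
  indicator (a ∷ x ≟ᶜ b ∷ y) ≡ indicator (a ≟ᶠ b) * indicator (x ≟ᶜ y)
indicator-∷ a b x y =
  trans (indicator-cong (a ∷ x ≟ᶜ b ∷ y) ((a ≟ᶠ b) ×-dec (x ≟ᶜ y))
                        ∷-injective λ (a≡b , x≡y) → cong₂ _∷_ a≡b x≡y)
        (indicator-×-dec (a ≟ᶠ b) (x ≟ᶜ y))

∑-allConfigs-indicator-≡ : ∀ {q n} (x : Config q n) → ∑[ z ← allConfigs q n ] indicator (x ≟ᶜ z) ≡ 1
∑-allConfigs-indicator-≡ [] = refl
∑-allConfigs-indicator-≡ {q} {suc n} (a ∷ x) = begin
  ∑[ z ← allConfigs q (suc n) ] indicator (a ∷ x ≟ᶜ z)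
    ≡⟨ ∑-allConfigs-suc q n (λ z → indicator (a ∷ x ≟ᶜ z)) ⟩
  ∑[ b ← allFin q ] ∑[ y ← allConfigs q n ] indicator (a ∷ x ≟ᶜ b ∷ y)
    ≡⟨ ∑-cong (allFin q) (λ b → ∑-cong (allConfigs q n) (indicator-∷ a b x)) ⟩
  ∑[ b ← allFin q ] ∑[ y ← allConfigs q n ] (indicator (a ≟ᶠ b) * indicator (x ≟ᶜ y))
    ≡⟨ ∑-cong (allFin q) (λ b → ∑-*ˡ (indicator (a ≟ᶠ b)) (λ y → indicator (x ≟ᶜ y)) (allConfigs q n)) ⟩
  ∑[ b ← allFin q ] (indicator (a ≟ᶠ b) * ∑[ y ← allConfigs q n ] indicator (x ≟ᶜ y))
    ≡⟨ ∑-cong (allFin q) (λ b → cong (indicator (a ≟ᶠ b) *_) (∑-allConfigs-indicator-≡ x)) ⟩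
  ∑[ b ← allFin q ] (indicator (a ≟ᶠ b) * 1)
    ≡⟨ ∑-cong (allFin q) (λ b → *-identityʳ (indicator (a ≟ᶠ b))) ⟩
  ∑[ b ← allFin q ] indicator (a ≟ᶠ b)
    ≡⟨ ∑-allFin-indicator-≡ a ⟩
  1 ∎
  where open ≡-Reasoning

∑-preimageCount : ∀ {q n} (F : AN q n) (w : Config q n → ℕ) →
  ∑[ z ← allConfigs q n ] (w z * preimageCount F z) ≡ ∑[ x ← allConfigs q n ] w (F x)
∑-preimageCount {q} {n} F w = begin
  ∑[ z ← Ω ] (w z * preimageCount F z)
    ≡⟨ ∑-cong Ω (λ z → cong (w z *_) (length-filter≡∑indicator (λ x → F x ≟ᶜ z) Ω)) ⟩
  ∑[ z ← Ω ] (w z * ∑[ x ← Ω ] indicator (F x ≟ᶜ z))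
    ≡⟨ ∑-cong Ω (λ z → sym (∑-*ˡ (w z) (λ x → indicator (F x ≟ᶜ z)) Ω)) ⟩
  ∑[ z ← Ω ] ∑[ x ← Ω ] (w z * indicator (F x ≟ᶜ z))
    ≡⟨ ∑-comm (λ z x → w z * indicator (F x ≟ᶜ z)) Ω Ω ⟩
  ∑[ x ← Ω ] ∑[ z ← Ω ] (w z * indicator (F x ≟ᶜ z))
    ≡⟨ ∑-cong Ω (λ x → ∑-cong Ω (λ z → weight-at (F x) z (F x ≟ᶜ z))) ⟩
  ∑[ x ← Ω ] ∑[ z ← Ω ] (w (F x) * indicator (F x ≟ᶜ z))
    ≡⟨ ∑-cong Ω (λ x → ∑-*ˡ (w (F x)) (λ z → indicator (F x ≟ᶜ z)) Ω) ⟩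
  ∑[ x ← Ω ] (w (F x) * ∑[ z ← Ω ] indicator (F x ≟ᶜ z))
    ≡⟨ ∑-cong Ω (λ x → trans (cong (w (F x) *_) (∑-allConfigs-indicator-≡ (F x))) (*-identityʳ (w (F x)))) ⟩
  ∑[ x ← Ω ] w (F x) ∎
  where
  open ≡-Reasoning
  Ω : List (Config q n)
  Ω = allConfigs q n
  weight-at : ∀ y z (y≟z : Dec (y ≡ z)) → w z * indicator y≟z ≡ w y * indicator y≟z
  weight-at y .y (yes refl) = refl
  weight-at y z (no _) = trans (*-zeroʳ (w z)) (sym (*-zeroʳ (w y)))

-- Functions depending on few coordinates

Agree : ∀ {q n} → Subset n → Config q n → Config q n → Set
Agree S x x' = ∀ i → i ∈ₛ S → lookup x i ≡ lookup x' i

DependsOnlyOn : ∀ {a} {A : Set a} {q n} → Subset n → (Config q n → A) → Set a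
DependsOnlyOn {q = q} {n} S g = ∀ (x x' : Config q n) → Agree S x x' → g x ≡ g x'

-- Arc F i j is, by definition, EffectivelyDependsOn (λ x → lookup (F x) j) i.
EffectivelyDependsOn : ∀ {a} {A : Set a} {q n} → (Config q n → A) → Fin n → Set a
EffectivelyDependsOn g i = ∃ λ x → ∃ λ x' → DifferOnlyAt i x x' × g x ≢ g x'

Agree-⊆ : ∀ {q n} {S T : Subset n} {x x' : Config q n} → S ⊆ T → Agree T x x' → Agree S x x'
Agree-⊆ S⊆T agree i i∈S = agree i (S⊆T i∈S)

Agree-∷ : ∀ {q n} {S : Subset n} s a {x x' : Config q n} → Agree S x x' → Agree (s ∷ S) (a ∷ x) (a ∷ x')
Agree-∷ s a agree zero _ = refl
Agree-∷ s a agree (suc i) i∈s∷S = agree i (drop-there i∈s∷S)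

Agree-outside∷ : ∀ {q n} {S : Subset n} a b {x x' : Config q n} →
  Agree S x x' → Agree (outside ∷ S) (a ∷ x) (b ∷ x')
Agree-outside∷ a b agree zero ()
Agree-outside∷ a b agree (suc i) i∈S = agree i (drop-there i∈S)

overwrite : ∀ {q n} → Config q n → List (Fin n) → Config q n → Config q n
overwrite x' [] y = y
overwrite x' (i ∷ is) y = overwrite x' is (y [ i ]≔ lookup x' i)

lookup-[]≔-lookup : ∀ {q n} (x' y : Config q n) i k → k ≡ i ⊎ lookup y k ≡ lookup x' k →
  lookup (y [ i ]≔ lookup x' i) k ≡ lookup x' k
lookup-[]≔-lookup x' y i k k≡i⊎agree with k ≟ᶠ i | k≡i⊎agree
... | yes refl | _ = lookup∘update k y (lookup x' k)
... | no k≢i | inj₁ k≡i = ⊥-elim (k≢i k≡i)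
... | no k≢i | inj₂ agree = trans (lookup∘update′ k≢i y (lookup x' i)) agree

lookup-overwrite : ∀ {q n} (x' : Config q n) is y k → k ∈ is ⊎ lookup y k ≡ lookup x' k →
  lookup (overwrite x' is y) k ≡ lookup x' k
lookup-overwrite x' [] y k (inj₂ agree) = agree
lookup-overwrite x' (i ∷ is) y k (inj₁ (here k≡i)) =
  lookup-overwrite x' is _ k (inj₂ (lookup-[]≔-lookup x' y i k (inj₁ k≡i)))
lookup-overwrite x' (i ∷ is) y k (inj₁ (there k∈is)) = lookup-overwrite x' is _ k (inj₁ k∈is)
lookup-overwrite x' (i ∷ is) y k (inj₂ agree) =
  lookup-overwrite x' is _ k (inj₂ (lookup-[]≔-lookup x' y i k (inj₂ agree)))

overwrite-allFin : ∀ {q n} (x' y : Config q n) → overwrite x' (allFin n) y ≡ x'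
overwrite-allFin x' y = Pointwise-≡⇒≡ (ext λ k → lookup-overwrite x' (allFin _) y k (inj₁ (∈-allFin k)))

module _ {a} {A : Set a} (_≟ᴬ_ : DecidableEquality A) {q n} (g : Config q n → A) (S : Subset n)
         (S-covers : ∀ i → EffectivelyDependsOn g i → i ∈ₛ S) where

  update-preserves : ∀ y i v → (i ∈ₛ S → lookup y i ≡ v) → g y ≡ g (y [ i ]≔ v)
  update-preserves y i v i∈S⇒unchanged with g y ≟ᴬ g (y [ i ]≔ v)
  ... | yes gy≡gy' = gy≡gy'
  ... | no gy≢gy' = ⊥-elim (gy≢gy' (cong g (sym y[i]≔v≡y)))
    where
    i∈S : i ∈ₛ S
    i∈S = S-covers i (y , y [ i ]≔ v , (λ k k≢i → sym (lookup∘update′ k≢i y v)) , gy≢gy')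
    y[i]≔v≡y : y [ i ]≔ v ≡ y
    y[i]≔v≡y = trans (cong (y [ i ]≔_) (sym (i∈S⇒unchanged i∈S))) ([]≔-lookup y i)

  overwrite-preserves : ∀ x' is y → Agree S y x' → g y ≡ g (overwrite x' is y)
  overwrite-preserves x' [] y _ = refl
  overwrite-preserves x' (i ∷ is) y agree =
    trans (update-preserves y i (lookup x' i) (agree i))
          (overwrite-preserves x' is _ λ k k∈S → lookup-[]≔-lookup x' y i k (inj₂ (agree k k∈S)))

  dependsOnlyOn-cover : DependsOnlyOn S g
  dependsOnlyOn-cover x x' agree =
    trans (overwrite-preserves x' (allFin n) x agree) (cong g (overwrite-allFin x' x))

^-monoʳ-∣ : ∀ q {m n} → m ≤ n → q ^ m ∣ q ^ n
^-monoʳ-∣ q {m} {n} m≤n = divides (q ^ (n ∸ m)) (begin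
  q ^ n              ≡⟨ cong (q ^_) (sym (m+[n∸m]≡n m≤n)) ⟩
  q ^ (m + (n ∸ m))  ≡⟨ ^-distribˡ-+-* q m (n ∸ m) ⟩
  q ^ m * q ^ (n ∸ m) ≡⟨ *-comm (q ^ m) (q ^ (n ∸ m)) ⟩
  q ^ (n ∸ m) * q ^ m ∎)
  where open ≡-Reasoning

∑-allFin-const-∣ : ∀ q {e} (I : Fin q → ℕ) → (∀ a → q ^ e ∣ I a) → (∀ a b → I a ≡ I b) →
  q ^ suc e ∣ ∑ I (allFin q)
∑-allFin-const-∣ zero I _ _ = divides 0 refl
∑-allFin-const-∣ (suc q) {e} I q^e∣I I-const = subst (suc q ^ suc e ∣_) (sym ∑I≡) (*-monoʳ-∣ (suc q) (q^e∣I zero))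
  where
  ∑I≡ : ∑ I (allFin (suc q)) ≡ suc q * I zero
  ∑I≡ = trans (∑-cong (allFin (suc q)) (λ a → I-const a zero))
              (trans (∑-const (I zero) (allFin (suc q))) (cong (_* I zero) (length-tabulate {n = suc q} (λ a → a))))

q^[n∸∣S∣]∣∑ : ∀ {q n} (S : Subset n) (f : Config q n → ℕ) → DependsOnlyOn S f →
  q ^ (n ∸ ∣ S ∣) ∣ ∑ f (allConfigs q n)
q^[n∸∣S∣]∣∑ [] f _ = 1∣ _
q^[n∸∣S∣]∣∑ {q} {suc n} (inside ∷ S) f f-local =
  subst (_ ∣_) (sym (∑-allConfigs-suc q n f))
    (∑-∣ _ (allFin q) λ a →
      q^[n∸∣S∣]∣∑ S (λ x → f (a ∷ x)) λ x x' agree → f-local _ _ (Agree-∷ inside a agree))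
q^[n∸∣S∣]∣∑ {q} {suc n} (outside ∷ S) f f-local =
  subst₂ _∣_ (cong (q ^_) (sym (+-∸-assoc 1 (∣p∣≤n S)))) (sym (∑-allConfigs-suc q n f))
    (∑-allFin-const-∣ q {n ∸ ∣ S ∣} I
      (λ a → q^[n∸∣S∣]∣∑ S (λ x → f (a ∷ x)) λ x x' agree → f-local _ _ (Agree-∷ outside a agree))
      (λ a b → ∑-cong (allConfigs q n) λ x → f-local _ _ (Agree-outside∷ a b λ _ _ → refl)))
  where
  I : Fin q → ℕ
  I a = ∑[ x ← allConfigs q n ] f (a ∷ x)

∣p∪q∣≤∣p∣+∣q∣ : ∀ {n} (p q : Subset n) → ∣ p ∪ q ∣ ≤ ∣ p ∣ + ∣ q ∣
∣p∪q∣≤∣p∣+∣q∣ [] [] = z≤n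
∣p∪q∣≤∣p∣+∣q∣ (inside ∷ p) (inside ∷ r) = s≤s (≤-trans (∣p∪q∣≤∣p∣+∣q∣ p r) (+-monoʳ-≤ ∣ p ∣ (n≤1+n _)))
∣p∪q∣≤∣p∣+∣q∣ (inside ∷ p) (outside ∷ r) = s≤s (∣p∪q∣≤∣p∣+∣q∣ p r)
∣p∪q∣≤∣p∣+∣q∣ (outside ∷ p) (inside ∷ r) =
  ≤-trans (s≤s (∣p∪q∣≤∣p∣+∣q∣ p r)) (≤-reflexive (sym (+-suc ∣ p ∣ ∣ r ∣)))
∣p∪q∣≤∣p∣+∣q∣ (outside ∷ p) (outside ∷ r) = ∣p∪q∣≤∣p∣+∣q∣ p r

module _ {a} {A : Set a} {n} (f : A → Subset n) where

  ∣⋃map∣≤length*k : ∀ {k} xs → (∀ x → ∣ f x ∣ ≤ k) → ∣ ⋃ (map f xs) ∣ ≤ length xs * k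
  ∣⋃map∣≤length*k [] _ = ≤-reflexive (∣⊥∣≡0 n)
  ∣⋃map∣≤length*k (x ∷ xs) ∣f∣≤k =
    ≤-trans (∣p∪q∣≤∣p∣+∣q∣ (f x) (⋃ (map f xs))) (+-mono-≤ (∣f∣≤k x) (∣⋃map∣≤length*k xs ∣f∣≤k))

  ∈⇒⊆⋃map : ∀ {x} xs → x ∈ xs → f x ⊆ ⋃ (map f xs)
  ∈⇒⊆⋃map (y ∷ xs) (here refl) = p⊆p∪q (⋃ (map f xs))
  ∈⇒⊆⋃map (y ∷ xs) (there x∈xs) = q⊆p∪q (f y) (⋃ (map f xs)) ∘ ∈⇒⊆⋃map xs x∈xs

-- The counting argument

module LowerBound {q n d} .{{_ : NonZero d}} (F : AN q n) (F-degree : DegreeAtMost F d)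
                  (default : Fin n) (y₀ : Config q n) (y₀∈Y₀ : preimageCount F y₀ ≡ 0) where

  Ω : List (Config q n)
  Ω = allConfigs q n

  Y≥2 : List (Config q n)
  Y≥2 = filter (λ y → 2 ≤? preimageCount F y) Ω

  N : Fin n → Subset n
  N j = proj₁ (F-degree j)

  differs? : (y : Config q n) → Dec (∃ λ k → lookup y k ≢ lookup y₀ k)
  differs? y = any? (λ k → ¬? (lookup y k ≟ᶠ lookup y₀ k))

  -- The default coordinate is only chosen for y = y₀, which is not in Y≥2.
  separator : Config q n → Fin n
  separator y with differs? y
  ... | yes (k , _) = k
  ... | no _ = default

  separator-separates : ∀ y → y ≢ y₀ → lookup y (separator y) ≢ lookup y₀ (separator y)
  separator-separates y y≢y₀ with differs? y
  ... | yes (_ , y≢y₀-at-k) = y≢y₀-at-k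
  ... | no ¬differs = ⊥-elim (y≢y₀ (Pointwise-≡⇒≡ (ext λ k →
          decidable-stable (lookup y k ≟ᶠ lookup y₀ k) λ y≢y₀-at-k → ¬differs (k , y≢y₀-at-k))))

  Z : Config q n → Set
  Z z = All (λ y → lookup z (separator y) ≡ lookup y₀ (separator y)) Y≥2

  Z? : Decidable Z
  Z? z = all? (λ y → lookup z (separator y) ≟ᶠ lookup y₀ (separator y)) Y≥2

  𝟙Z : Config q n → ℕ
  𝟙Z z = indicator (Z? z)

  J U : Subset n
  J = ⋃ (map (λ y → ⁅ separator y ⁆) Y≥2)
  U = ⋃ (map (N ∘ separator) Y≥2)

  ∣J∣≤∣Y≥2∣*d : ∣ J ∣ ≤ length Y≥2 * d
  ∣J∣≤∣Y≥2∣*d = ∣⋃map∣≤length*k _ Y≥2 (λ y → ≤-trans (≤-reflexive (∣⁅x⁆∣≡1 (separator y))) (>-nonZero⁻¹ d))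

  ∣U∣≤∣Y≥2∣*d : ∣ U ∣ ≤ length Y≥2 * d
  ∣U∣≤∣Y≥2∣*d = ∣⋃map∣≤length*k _ Y≥2 (λ y → proj₁ (proj₂ (F-degree (separator y))))

  Z-respects : ∀ {z z'} → (∀ {y} → y ∈ Y≥2 → lookup z (separator y) ≡ lookup z' (separator y)) →
    Z z → Z z'
  Z-respects z≡z' z∈Z = All.tabulate λ y∈Y≥2 → trans (sym (z≡z' y∈Y≥2)) (All.lookup z∈Z y∈Y≥2)

  𝟙Z-cong : ∀ z z' → (∀ {y} → y ∈ Y≥2 → lookup z (separator y) ≡ lookup z' (separator y)) →
    𝟙Z z ≡ 𝟙Z z'
  𝟙Z-cong z z' z≡z' = indicator-cong _ _ (Z-respects {z} {z'} z≡z') (Z-respects {z'} {z} (sym ∘ z≡z'))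

  𝟙Z-local : DependsOnlyOn J 𝟙Z
  𝟙Z-local z z' agree = 𝟙Z-cong z z' λ {y} y∈Y≥2 →
    agree (separator y) (∈⇒⊆⋃map (λ y → ⁅ separator y ⁆) Y≥2 y∈Y≥2 (x∈⁅x⁆ (separator y)))

  𝟙Z∘F-local : DependsOnlyOn U (𝟙Z ∘ F)
  𝟙Z∘F-local x x' agree = 𝟙Z-cong (F x) (F x') λ {y} y∈Y≥2 →
    let j = separator y in
    dependsOnlyOn-cover _≟ᶠ_ (λ x → lookup (F x) j) (N j) (proj₂ (proj₂ (F-degree j))) x x'
      (Agree-⊆ {x = x} {x'} (∈⇒⊆⋃map (N ∘ separator) Y≥2 y∈Y≥2) agree)

  Z⇒preimageCount≤1 : ∀ z → Z z → preimageCount F z ≤ 1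
  Z⇒preimageCount≤1 z z∈Z with 2 ≤? preimageCount F z
  ... | no ≱2 = ≤-pred (≰⇒> ≱2)
  ... | yes ≥2 = ⊥-elim (separator-separates z z≢y₀ (All.lookup z∈Z z∈Y≥2))
    where
    z∈Y≥2 : z ∈ Y≥2
    z∈Y≥2 = ∈-filter⁺ (λ y → 2 ≤? preimageCount F y) (∈-allConfigs z) ≥2
    z≢y₀ : z ≢ y₀
    z≢y₀ refl with () ← subst (2 ≤_) y₀∈Y₀ ≥2

  𝟙Y₀ : Config q n → ℕ
  𝟙Y₀ z = indicator (preimageCount F z ℕ.≟ 0)

  |Z| |Z∩Y₀| |F⁻¹Z| : ℕ
  |Z| = ∑ 𝟙Z Ω
  |Z∩Y₀| = ∑[ z ← Ω ] (𝟙Z z * 𝟙Y₀ z)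
  |F⁻¹Z| = ∑[ x ← Ω ] 𝟙Z (F x)

  𝟙Z-split : ∀ z → 𝟙Z z ≡ 𝟙Z z * 𝟙Y₀ z + 𝟙Z z * preimageCount F z
  𝟙Z-split z with Z? z
  ... | no _ = refl
  ... | yes z∈Z = sym (trans (cong₂ _+_ (*-identityˡ (𝟙Y₀ z)) (*-identityˡ (preimageCount F z)))
                             (indicator[≡0]+id (preimageCount F z) (Z⇒preimageCount≤1 z z∈Z)))

  |Z|≡|Z∩Y₀|+|F⁻¹Z| : |Z| ≡ |Z∩Y₀| + |F⁻¹Z|
  |Z|≡|Z∩Y₀|+|F⁻¹Z| = begin
    ∑ 𝟙Z Ω
      ≡⟨ ∑-cong Ω 𝟙Z-split ⟩
    ∑[ z ← Ω ] (𝟙Z z * 𝟙Y₀ z + 𝟙Z z * preimageCount F z)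
      ≡⟨ ∑-distrib-+ (λ z → 𝟙Z z * 𝟙Y₀ z) (λ z → 𝟙Z z * preimageCount F z) Ω ⟩
    |Z∩Y₀| + ∑[ z ← Ω ] (𝟙Z z * preimageCount F z)
      ≡⟨ cong (|Z∩Y₀| +_) (∑-preimageCount F 𝟙Z) ⟩
    |Z∩Y₀| + |F⁻¹Z| ∎
    where open ≡-Reasoning

  q^[n∸∣Y≥2∣*d] : ℕ
  q^[n∸∣Y≥2∣*d] = q ^ (n ∸ length Y≥2 * d)

  q^[n∸∣Y≥2∣*d]∣|Z∩Y₀| : q^[n∸∣Y≥2∣*d] ∣ |Z∩Y₀|
  q^[n∸∣Y≥2∣*d]∣|Z∩Y₀| = ∣m+n∣m⇒∣n (subst (q^[n∸∣Y≥2∣*d] ∣_) |Z|≡|F⁻¹Z|+|Z∩Y₀| ∣|Z|) ∣|F⁻¹Z|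
    where
    |Z|≡|F⁻¹Z|+|Z∩Y₀| : |Z| ≡ |F⁻¹Z| + |Z∩Y₀|
    |Z|≡|F⁻¹Z|+|Z∩Y₀| = trans |Z|≡|Z∩Y₀|+|F⁻¹Z| (+-comm |Z∩Y₀| |F⁻¹Z|)
    ∣|Z| : q^[n∸∣Y≥2∣*d] ∣ |Z|
    ∣|Z| = ∣-trans (^-monoʳ-∣ q (∸-monoʳ-≤ n ∣J∣≤∣Y≥2∣*d)) (q^[n∸∣S∣]∣∑ J 𝟙Z 𝟙Z-local)
    ∣|F⁻¹Z| : q^[n∸∣Y≥2∣*d] ∣ |F⁻¹Z|
    ∣|F⁻¹Z| = ∣-trans (^-monoʳ-∣ q (∸-monoʳ-≤ n ∣U∣≤∣Y≥2∣*d)) (q^[n∸∣S∣]∣∑ U (𝟙Z ∘ F) 𝟙Z∘F-local)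

  y₀∈Z∩Y₀ : 1 ≤ |Z∩Y₀|
  y₀∈Z∩Y₀ = ≤-trans (≤-reflexive (sym 𝟙Z∩Y₀[y₀]≡1)) (∈⇒≤∑ (λ z → 𝟙Z z * 𝟙Y₀ z) Ω (∈-allConfigs y₀))
    where
    𝟙Z∩Y₀[y₀]≡1 : 𝟙Z y₀ * 𝟙Y₀ y₀ ≡ 1
    𝟙Z∩Y₀[y₀]≡1 = cong₂ _*_ (indicator-yes (Z? y₀) (All.tabulate λ _ → refl))
                            (indicator-yes (preimageCount F y₀ ℕ.≟ 0) y₀∈Y₀)

  |Z∩Y₀|≤cardY0 : |Z∩Y₀| ≤ cardY0 F
  |Z∩Y₀|≤cardY0 = ≤-trans
    (∑-mono-≤ Ω (λ z → ≤-trans (*-monoˡ-≤ (𝟙Y₀ z) (indicator≤1 (Z? z))) (≤-reflexive (*-identityˡ (𝟙Y₀ z)))))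
    (≤-reflexive (sym (length-filter≡∑indicator (λ z → preimageCount F z ℕ.≟ 0) Ω)))

  q^[n∸∣Y≥2∣*d]≤cardY0 : q ^ (n ∸ cardY≥2 F * d) ≤ cardY0 F
  q^[n∸∣Y≥2∣*d]≤cardY0 = ≤-trans (∣⇒≤ {{>-nonZero y₀∈Z∩Y₀}} q^[n∸∣Y≥2∣*d]∣|Z∩Y₀|) |Z∩Y₀|≤cardY0

lemma3 : (q n d : ℕ) → 2 ≤ q → 1 ≤ n → .{{_ : NonZero d}} →
    (F : AN q n) → DegreeAtMost F d →
    1 ≤ cardY0 F → cardY≥2 F ≤ n / d →
    q ^ (n ∸ cardY≥2 F * d) ≤ cardY0 F
lemma3 q n d _ 1≤n F F-degree 1≤cardY0 _
  with filter-nonempty⇒∃ (λ y → preimageCount F y ℕ.≟ 0) (allConfigs q n) 1≤cardY0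
... | y₀ , y₀∈Y₀ = LowerBound.q^[n∸∣Y≥2∣*d]≤cardY0 F F-degree (fromℕ< 1≤n) y₀ y₀∈Y₀
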